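{- In the setting described in the context, let $u,v$ be two distinct vertices of $B$ and pick a vertex $w\in A$ uniformly at random. Then the probability that $w$ is bad with respect to the pair $\{u,v\}$ is at most $\frac{n}{2^{12}k^4|A|}$.
   Context: Setting: Let $0<\beta<1/5$, let $n$ be a positive integer and $k=n^{\beta}$, with $n>2^{20}k^5$. Let $G$ be a graph on $n$ vertices with at least $n^2/k$ edges. Let $G_1$ be the induced subgraph of $G$ obtained by repeatedly deleting a vertex of minimum degree until the remaining graph has minimum degree at least $\frac{n}{2k}$. Let $H$ be a bipartite subgraph of $G_1$ with the maximum possible number of edges, with vertex classes $A$ and $B$ labelled so that $|B|\le |A|$. For vertices $x_1,x_2$ of $H$, $N_H(x_1,x_2)$ denotes the set of vertices of $H$ adjacent to both, and $d_H(x_1,x_2)=|N_H(x_1,x_2)|$ is their codegree. $\Gamma$ is the auxiliary graph with vertex set $A$ in which two distinct vertices $x,y$ are adjacent if and only if $d_H(x,y)\ge \frac{n}{32k^2}$. For $u,v\in B$, a vertex $w\in A$ is bad with respect to $\{u,v\}$ if $w\in N_H(u,v)$ and $w$ has degree at most $\frac{n}{2^{16}k^5}$ in the induced subgraph $\Gamma[N_H(u,v)]$.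
   Formalization: The parameter $k=n^{\beta}$ is taken to be rational. -}

module Defs where

open import Data.Nat as ℕ using (ℕ; zero; suc)
open import Data.Integer using (+_)
open import Data.Fin using (Fin; zero; suc; toℕ; _≟_)
open import Data.Bool using (Bool; true; false; _∧_; _∨_; not; if_then_else_)
open import Data.Rational as ℚ using (ℚ; _/_)
open import Data.Rational.Properties using (_≤?_)
open import Relation.Nullary.Decidable using (⌊_⌋)
open import Relation.Binary.PropositionalEquality using (_≡_)

q : ℕ → ℚ
q m = + m / 1

_^ℚ_ : ℚ → ℕ → ℚ
x ^ℚ zero = ℚ.1ℚ
x ^ℚ suc m = x ℚ.* (x ^ℚ m)

sumF : ∀ {n} → (Fin n → ℕ) → ℕ
sumF {zero} f = 0
sumF {suc n} f = f zero ℕ.+ sumF (λ i → f (suc i))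

count : ∀ {n} → (Fin n → Bool) → ℕ
count P = sumF (λ i → if P i then 1 else 0)

VSet : ℕ → Set
VSet n = Fin n → Bool

full : ∀ {n} → VSet n
full _ = true

remove : ∀ {n} → Fin n → VSet n → VSet n
remove v S w = S w ∧ not ⌊ w ≟ v ⌋

record Graph (n : ℕ) : Set where
  field
    adj    : Fin n → Fin n → Bool
    sym    : ∀ x y → adj x y ≡ adj y x
    irrefl : ∀ x → adj x x ≡ false
open Graph public

edgeCountRel : ∀ {n} → (Fin n → Fin n → Bool) → ℕ
edgeCountRel a = sumF (λ x → count (λ y → ⌊ toℕ x ℕ.<? toℕ y ⌋ ∧ a x y))

edgeCount : ∀ {n} → Graph n → ℕ
edgeCount G = edgeCountRel (adj G)

degIn : ∀ {n} → Graph n → VSet n → Fin n → ℕ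
degIn G S v = count (λ y → S y ∧ adj G v y)

-- Peel G k S T : starting from the induced subgraph G[S], repeatedly deleting a vertex
-- of minimum degree until the minimum degree is at least n/(2k) ends at G[T].
-- (Every valid sequence of choices among tied minimum-degree vertices is allowed.)
data Peel {n : ℕ} (G : Graph n) (k : ℚ) : VSet n → VSet n → Set where
  stop : ∀ {S} →
         (∀ v → S v ≡ true → q n ℚ.≤ q (degIn G S v) ℚ.* (q 2 ℚ.* k)) →
         Peel G k S S
  del  : ∀ {S T} (v : Fin n) → S v ≡ true →
         (∀ w → S w ≡ true → degIn G S v ℕ.≤ degIn G S w) →
         q (degIn G S v) ℚ.* (q 2 ℚ.* k) ℚ.< q n →
         Peel G k (remove v S) T → Peel G k S T

IsPartition : ∀ {n} → VSet n → VSet n → VSet n → Set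
IsPartition T A B = (∀ x → T x ≡ (A x ∨ B x)) × (∀ x → (A x ∧ B x) ≡ false)
  where open import Data.Product using (_×_)

crossAdj : ∀ {n} → Graph n → VSet n → VSet n → Fin n → Fin n → Bool
crossAdj G A B x y = adj G x y ∧ ((A x ∧ B y) ∨ (B x ∧ A y))

IsMaxBipartite : ∀ {n} → Graph n → VSet n → VSet n → VSet n → Set
IsMaxBipartite G T A B =
  IsPartition T A B ×
  (∀ A' B' → IsPartition T A' B' →
     edgeCountRel (crossAdj G A' B') ℕ.≤ edgeCountRel (crossAdj G A B))
  where open import Data.Product using (_×_)

codeg : ∀ {n} → (Fin n → Fin n → Bool) → Fin n → Fin n → ℕ
codeg h x y = count (λ z → h x z ∧ h y z)

NH : ∀ {n} → (Fin n → Fin n → Bool) → Fin n → Fin n → VSet n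
NH h u v z = h u z ∧ h v z

ΓAdj : ∀ {n} → ℚ → (Fin n → Fin n → Bool) → VSet n → Fin n → Fin n → Bool
ΓAdj {n} k h A x y =
  A x ∧ A y ∧ not ⌊ x ≟ y ⌋ ∧ ⌊ q n ≤? q (codeg h x y) ℚ.* (q 32 ℚ.* (k ^ℚ 2)) ⌋

bad : ∀ {n} → ℚ → (Fin n → Fin n → Bool) → VSet n → Fin n → Fin n → Fin n → Bool
bad {n} k h A u v w =
  NH h u v w ∧
  ⌊ q (count (λ x → NH h u v x ∧ ΓAdj k h A w x)) ℚ.* (q (2 ℕ.^ 16) ℚ.* (k ^ℚ 5)) ≤? q n ⌋

-- probability that a uniformly random element of the (finite) set A satisfies P
-- (defined as 0 when A is empty)
Pr : ∀ {n} → VSet n → (Fin n → Bool) → ℚ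
Pr A P with count A
... | zero = ℚ.0ℚ
... | suc m = + count (λ x → A x ∧ P x) / suc m

-- A vertex w of A survived the peeling, so deg_T(w) ≥ n/(2k),
-- and by local optimality of the maximum cut deg_H(w) ≥ deg_T(w)/2 ≥ n/(4k); its
-- H-neighbourhood lies in B, and |B| ≤ n/2.  Every bad vertex has at most
-- Δ = n/(2¹⁶k⁵) Γ-neighbours among the bad vertices, so a greedy choice finds m+1
-- bad vertices, pairwise Γ-non-adjacent (codegree < n/(32k²)), as soon as there are
-- more than m(Δ+1) bad vertices.  Taking 4k < m+1 ≤ 8k, Bonferroni's inequality
--   (m+1)·n/(4k) ≤ Σ deg_H ≤ |B| + C(m+1,2)·n/(32k²)
-- is impossible, hence there are at most m(Δ+1) ≤ 16kΔ = n/(2¹²k⁴) bad vertices.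
module Submission where

module FiniteSums where
  open import Defs using (sumF; count)
  open import Data.Nat using (ℕ; zero; suc; _+_; _≤_; _<_; z≤n; s≤s)
  open import Data.Nat.Properties
    using (+-identityʳ; +-mono-≤; m≤n⇒m≤1+n; ≤-trans; ≤-refl; +-commutativeSemigroup)
  open import Algebra.Properties.CommutativeSemigroup +-commutativeSemigroup using (interchange)
  open import Data.Fin using (Fin; zero; suc; _≟_)
  open import Data.Bool using (Bool; true; false; _∧_; _∨_; if_then_else_)
  open import Data.Product using (Σ; _,_)
  open import Data.Fin.Properties using (suc-injective)
  open import Relation.Nullary.Decidable using (⌊_⌋; ⌊⌋-map′)
  open import Relation.Binary.PropositionalEquality
    using (_≡_; refl; cong; cong₂; trans; subst)

  ι : Bool → ℕ
  ι b = if b then 1 else 0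

  sumF-cong : ∀ {n} {f g : Fin n → ℕ} → (∀ i → f i ≡ g i) → sumF f ≡ sumF g
  sumF-cong {zero} e = refl
  sumF-cong {suc n} e = cong₂ _+_ (e zero) (sumF-cong (λ i → e (suc i)))

  sumF-mono : ∀ {n} {f g : Fin n → ℕ} → (∀ i → f i ≤ g i) → sumF f ≤ sumF g
  sumF-mono {zero} e = z≤n
  sumF-mono {suc n} e = +-mono-≤ (e zero) (sumF-mono (λ i → e (suc i)))

  sumF-+ : ∀ {n} (f g : Fin n → ℕ) → sumF (λ i → f i + g i) ≡ sumF f + sumF g
  sumF-+ {zero} f g = refl
  sumF-+ {suc n} f g =
    trans (cong (f zero + g zero +_) (sumF-+ (λ i → f (suc i)) (λ i → g (suc i))))
          (interchange (f zero) (g zero) _ _)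

  sumF-+₃ : ∀ {n} (f g h : Fin n → ℕ) →
            sumF (λ i → f i + g i + h i) ≡ sumF f + sumF g + sumF h
  sumF-+₃ f g h = trans (sumF-+ (λ i → f i + g i) h) (cong (_+ sumF h) (sumF-+ f g))

  sumF-zero : ∀ {n} → sumF {n} (λ _ → 0) ≡ 0
  sumF-zero {zero} = refl
  sumF-zero {suc n} = sumF-zero {n}

  sumF-at : ∀ {n} (w : Fin n) (f : Fin n → ℕ) → sumF (λ i → if ⌊ i ≟ w ⌋ then f i else 0) ≡ f w
  sumF-at {suc n} zero f = trans (cong (f zero +_) (sumF-zero {n})) (+-identityʳ (f zero))
  sumF-at {suc n} (suc w) f =
    trans (sumF-cong (λ i → cong (λ b → if b then f (suc i) else 0)
                                 (⌊⌋-map′ (cong suc) suc-injective (i ≟ w))))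
          (sumF-at w (λ i → f (suc i)))

  count-guard : ∀ {n} (e : Bool) (P : Fin n → Bool) →
                count (λ y → e ∧ P y) ≡ (if e then count P else 0)
  count-guard true P = refl
  count-guard {n} false P = sumF-zero {n}

  count-at : ∀ {n} (w : Fin n) (P : Fin n → Bool) → count (λ y → ⌊ y ≟ w ⌋ ∧ P y) ≡ ι (P w)
  count-at w P = trans (sumF-cong (λ y → guard ⌊ y ≟ w ⌋ (P y))) (sumF-at w (λ y → ι (P y)))
    where
    guard : ∀ e b → ι (e ∧ b) ≡ (if e then ι b else 0)
    guard true b = refl
    guard false b = refl

  count-mono : ∀ {n} {P Q : Fin n → Bool} → (∀ i → P i ≡ true → Q i ≡ true) → count P ≤ count Q
  count-mono {P = P} {Q} P⊆Q = sumF-mono pointwise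
    where
    pointwise : ∀ i → ι (P i) ≤ ι (Q i)
    pointwise i with P i in Pi
    ... | false = z≤n
    ... | true rewrite P⊆Q i Pi = s≤s z≤n

  count-≤-size : ∀ {n} (P : Fin n → Bool) → count P ≤ n
  count-≤-size {zero} P = z≤n
  count-≤-size {suc n} P with P zero
  ... | true = s≤s (count-≤-size (λ i → P (suc i)))
  ... | false = m≤n⇒m≤1+n (count-≤-size (λ i → P (suc i)))

  count-disjoint : ∀ {n} (P Q : Fin n → Bool) → (∀ i → (P i ∧ Q i) ≡ false) → count P + count Q ≤ n
  count-disjoint {n} P Q disjoint =
    subst (_≤ n) (sumF-+ (λ i → ι (P i)) (λ i → ι (Q i)))
      (≤-trans (sumF-mono (λ i → union (P i) (Q i) (disjoint i))) (count-≤-size (λ i → P i ∨ Q i)))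
    where
    union : ∀ p q → (p ∧ q) ≡ false → ι p + ι q ≤ ι (p ∨ q)
    union true false _ = ≤-refl
    union false q _ = ≤-refl

  count-witness : ∀ {n} (P : Fin n → Bool) → 0 < count P → Σ (Fin n) (λ i → P i ≡ true)
  count-witness {suc n} P positive with P zero in P0
  ... | true = zero , P0
  ... | false with count-witness (λ i → P (suc i)) positive
  ...   | i , Pi = suc i , Pi

module RationalBridge where
  open import Defs using (q; _^ℚ_)
  open import Data.Nat as ℕ using (ℕ; zero; suc; _+_; _*_; _^_; _≤_; _<_; z≤n; s≤s; pred)
  import Data.Nat.Properties as ℕP
  open import Data.Integer as ℤ using (+_; -[1+_])
  import Data.Integer.Properties as ℤP
  open import Data.Rational as ℚ using (ℚ; mkℚ; toℚᵘ)
  open import Data.Rational.Unnormalised as ℚᵘ using (mkℚᵘ; _≃_; *≤*; *<*)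
  import Data.Rational.Unnormalised.Properties as ℚᵘP
  import Data.Rational.Properties as ℚP
  open import Data.Product using (Σ; _×_; _,_)
  open import Relation.Binary.PropositionalEquality using (_≡_; refl; sym; cong; subst; subst₂)

  -- The rational e equals N/B, where B ≥ 1.
  record Fraction (e : ℚ) (N B : ℕ) : Set where
    constructor fraction
    field
      positive : 1 ≤ B
      equation : toℚᵘ e ≃ mkℚᵘ (+ N) (pred B)

  fraction-cong : ∀ {e N N' B B'} → N ≡ N' → B ≡ B' → Fraction e N B → Fraction e N' B'
  fraction-cong refl refl f = f

  fraction-q : ∀ x → Fraction (q x) x 1
  fraction-q x = fraction (s≤s z≤n) (ℚP.toℚᵘ-fromℚᵘ (mkℚᵘ (+ x) 0))

  fraction-zero : Fraction ℚ.0ℚ 0 1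
  fraction-zero = fraction (s≤s z≤n) ℚᵘP.≃-refl

  fraction-div : ∀ c m → Fraction (+ c ℚ./ suc m) c (suc m)
  fraction-div c m = fraction (s≤s z≤n) (ℚP.toℚᵘ-fromℚᵘ (mkℚᵘ (+ c) m))

  fraction-* : ∀ {e e' N N' B B'} → Fraction e N B → Fraction e' N' B' →
    Fraction (e ℚ.* e') (N * N') (B * B')
  fraction-* {e} {e'} {N} {N'} (fraction (s≤s {n = D} _) eq) (fraction (s≤s {n = D'} _) eq') =
    fraction (s≤s z≤n)
      (ℚᵘP.≃-trans (ℚP.toℚᵘ-homo-* e e')
        (ℚᵘP.≃-trans (ℚᵘP.*-cong eq eq')
          (ℚᵘP.≃-reflexive (cong (λ z → mkℚᵘ z (D' + D * suc D')) (sym (ℤP.pos-* N N'))))))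

  fraction-^ : ∀ {e N B} → Fraction e N B → ∀ j → Fraction (e ^ℚ j) (N ^ j) (B ^ j)
  fraction-^ f zero = fraction (s≤s z≤n) ℚᵘP.≃-refl
  fraction-^ f (suc j) = fraction-* f (fraction-^ f j)

  fraction-scale : ∀ {e N B} c → Fraction e N B → Fraction (q c ℚ.* e) (c * N) B
  fraction-scale {B = B} c f = fraction-cong refl (ℕP.*-identityˡ B) (fraction-* (fraction-q c) f)

  ≤-cross : ∀ {p r N B N' B'} → Fraction p N B → Fraction r N' B' → p ℚ.≤ r → N * B' ≤ N' * B
  ≤-cross {N = N} {N' = N'} (fraction (s≤s {n = D} _) eq) (fraction (s≤s {n = D'} _) eq') p≤r
    with ℚᵘP.≤-respʳ-≃ eq' (ℚᵘP.≤-respˡ-≃ eq (ℚP.toℚᵘ-mono-≤ p≤r))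
  ... | *≤* cross rewrite sym (ℤP.pos-* N (suc D')) | sym (ℤP.pos-* N' (suc D)) = ℤP.drop‿+≤+ cross

  <-cross : ∀ {p r N B N' B'} → Fraction p N B → Fraction r N' B' → p ℚ.< r → N * B' < N' * B
  <-cross {N = N} {N' = N'} (fraction (s≤s {n = D} _) eq) (fraction (s≤s {n = D'} _) eq') p<r
    with ℚᵘP.<-respʳ-≃ eq' (ℚᵘP.<-respˡ-≃ eq (ℚP.toℚᵘ-mono-< p<r))
  ... | *<* cross rewrite sym (ℤP.pos-* N (suc D')) | sym (ℤP.pos-* N' (suc D)) = ℤP.drop‿+<+ cross

  ≤-from-cross : ∀ {p r N B N' B'} → Fraction p N B → Fraction r N' B' → N * B' ≤ N' * B → p ℚ.≤ r
  ≤-from-cross {N = N} {N' = N'} (fraction (s≤s {n = D} _) eq) (fraction (s≤s {n = D'} _) eq') cross =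
    ℚP.toℚᵘ-cancel-≤ (ℚᵘP.≤-respʳ-≃ (ℚᵘP.≃-sym eq') (ℚᵘP.≤-respˡ-≃ (ℚᵘP.≃-sym eq) (*≤* cross′)))
    where
    cross′ : (+ N) ℤ.* (+ suc D') ℤ.≤ (+ N') ℤ.* (+ suc D)
    cross′ rewrite sym (ℤP.pos-* N (suc D')) | sym (ℤP.pos-* N' (suc D)) = ℤ.+≤+ cross

  above-one : (k : ℚ) → q 1 ℚ.< k → Σ ℕ λ a → Σ ℕ λ b → Fraction k a b × b < a
  above-one (mkℚ (+ a) d _) 1<k = a , suc d , fraction (s≤s z≤n) ℚᵘP.≃-refl , b<a
    where
    b<a : suc d < a
    b<a = subst₂ _<_ (ℕP.+-identityʳ (suc d)) (ℕP.*-identityʳ a)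
            (<-cross (fraction-q 1) (fraction (s≤s z≤n) ℚᵘP.≃-refl) 1<k)
  above-one (mkℚ -[1+ a ] d _) (ℚ.*<* ())

  ≤-nat : ∀ {p N B} m → Fraction p N B → p ℚ.≤ q m → N ≤ m * B
  ≤-nat {N = N} m f p≤m = subst (_≤ m * _) (ℕP.*-identityʳ N) (≤-cross f (fraction-q m) p≤m)

  <-nat : ∀ {p N B} m → Fraction p N B → p ℚ.< q m → N < m * B
  <-nat {N = N} m f p<m = subst (_< m * _) (ℕP.*-identityʳ N) (<-cross f (fraction-q m) p<m)

  nat-≤ : ∀ {p N B} m → Fraction p N B → q m ℚ.≤ p → m * B ≤ N
  nat-≤ {N = N} m f m≤p = subst (m * _ ≤_) (ℕP.*-identityʳ N) (≤-cross (fraction-q m) f m≤p)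

  ≤-nat⁻¹ : ∀ {p N B} m → Fraction p N B → N ≤ m * B → p ℚ.≤ q m
  ≤-nat⁻¹ {N = N} m f N≤mB = ≤-from-cross f (fraction-q m) (subst (_≤ m * _) (sym (ℕP.*-identityʳ N)) N≤mB)

module LocalMaxCut where
  open import Defs hiding (sym)
  open import Data.Nat using (_+_; _*_; _≤_; _<?_)
  open import Data.Nat.Properties
    using (+-identityʳ; +-assoc; ≤-trans; ≤-refl; ≤-reflexive; m≤m+n;
           +-monoˡ-≤; +-cancelˡ-≤; <-asym; <-irrefl; ≮⇒≥; ≤-antisym)
  open import Data.Fin using (Fin; toℕ; _≟_)
  open import Data.Fin.Properties using (toℕ-injective)
  open import Data.Bool using (Bool; true; false; _∧_; _∨_; not; if_then_else_)
  open import Data.Bool.Properties using (∧-comm; ∧-zeroʳ; ∨-comm; ∨-identityʳ)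
  open import Data.Product using (_,_; proj₁; proj₂)
  open import Data.Empty using (⊥-elim)
  open import Relation.Nullary.Decidable using (⌊_⌋; yes; no)
  open import Relation.Binary.PropositionalEquality
    using (_≡_; refl; sym; trans; cong; cong₂; subst₂; module ≡-Reasoning)
  open FiniteSums

  precedes : ∀ {n} → Fin n → Fin n → Bool
  precedes x y = ⌊ toℕ x <? toℕ y ⌋

  avoiding : ∀ {n} → Fin n → (Fin n → Fin n → Bool) → Fin n → Fin n → Bool
  avoiding w r x y = not ⌊ x ≟ w ⌋ ∧ (not ⌊ y ≟ w ⌋ ∧ r x y)

  -- A pair (x, y) with x before y avoids w, starts at w, or ends at w; it cannot
  -- both start and end at w, as x precedes y.
  split-pair : ∀ l ex ey b → (ex ≡ true → ey ≡ true → l ≡ false) →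
    ι (l ∧ b) ≡ ι (l ∧ (not ex ∧ (not ey ∧ b))) + ι (ex ∧ (l ∧ b)) + ι (ey ∧ (l ∧ b))
  split-pair l true true b x=y rewrite x=y refl refl = refl
  split-pair false true false b _ = refl
  split-pair true true false b _ = sym (+-identityʳ (ι b))
  split-pair false false true b _ = refl
  split-pair true false true b _ = refl
  split-pair l false false b _ = sym (trans (+-identityʳ _) (+-identityʳ _))

  before-or-after : ∀ {n} (w y : Fin n) (b : Bool) → (y ≡ w → b ≡ false) →
    ι (precedes w y ∧ b) + ι (precedes y w ∧ b) ≡ ι b
  before-or-after w y b y≢w with toℕ w <? toℕ y | toℕ y <? toℕ w
  ... | yes w<y | yes y<w = ⊥-elim (<-asym w<y y<w)
  ... | yes _   | no _    = +-identityʳ (ι b)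
  ... | no _    | yes _   = refl
  ... | no w≮y  | no y≮w rewrite y≢w (toℕ-injective (≤-antisym (≮⇒≥ w≮y) (≮⇒≥ y≮w))) = refl

  pairs-from : ∀ {n} (w : Fin n) (R : Fin n → Fin n → Bool) →
    sumF (λ x → count (λ y → ⌊ x ≟ w ⌋ ∧ R x y)) ≡ count (R w)
  pairs-from w R = trans (sumF-cong (λ x → count-guard ⌊ x ≟ w ⌋ (R x))) (sumF-at w (λ x → count (R x)))

  pairs-to : ∀ {n} (w : Fin n) (R : Fin n → Fin n → Bool) →
    sumF (λ x → count (λ y → ⌊ y ≟ w ⌋ ∧ R x y)) ≡ count (λ x → R x w)
  pairs-to w R = sumF-cong (λ x → count-at w (R x))

  edgeCount-split : ∀ {n} (r : Fin n → Fin n → Bool) (w : Fin n) →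
    (∀ x y → r x y ≡ r y x) → r w w ≡ false →
    edgeCountRel r ≡ edgeCountRel (avoiding w r) + count (r w)
  edgeCount-split {n} r w r-sym no-loop = begin
    edgeCountRel r
      ≡⟨ sumF-cong (λ x → sumF-cong (λ y → split-pair (precedes x y) _ _ (r x y) (same-pair x y))) ⟩
    sumF (λ x → sumF (λ y → ι (away x y) + ι (from-w x y) + ι (to-w x y)))
      ≡⟨ sumF-cong (λ x → sumF-+₃ (λ y → ι (away x y)) (λ y → ι (from-w x y)) (λ y → ι (to-w x y))) ⟩
    sumF (λ x → count (away x) + count (from-w x) + count (to-w x))
      ≡⟨ sumF-+₃ (λ x → count (away x)) (λ x → count (from-w x)) (λ x → count (to-w x)) ⟩
    edgeCountRel (avoiding w r) + sumF (λ x → count (from-w x)) + sumF (λ x → count (to-w x))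
      ≡⟨ cong₂ (λ s t → edgeCountRel (avoiding w r) + s + t)
               (pairs-from w (λ x y → precedes x y ∧ r x y))
               (trans (pairs-to w (λ x y → precedes x y ∧ r x y))
                      (sumF-cong (λ y → cong (λ b → ι (precedes y w ∧ b)) (r-sym y w)))) ⟩
    edgeCountRel (avoiding w r) + count (λ y → precedes w y ∧ r w y) + count (λ y → precedes y w ∧ r w y)
      ≡⟨ +-assoc (edgeCountRel (avoiding w r)) _ _ ⟩
    edgeCountRel (avoiding w r) + (count (λ y → precedes w y ∧ r w y) + count (λ y → precedes y w ∧ r w y))
      ≡⟨ cong (edgeCountRel (avoiding w r) +_)
              (trans (sym (sumF-+ (λ y → ι (precedes w y ∧ r w y)) (λ y → ι (precedes y w ∧ r w y))))
                     (sumF-cong (λ y → before-or-after w y (r w y) no-loop-at))) ⟩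
    edgeCountRel (avoiding w r) + count (r w) ∎
    where
    open ≡-Reasoning
    away from-w to-w : Fin n → Fin n → Bool
    away x y = precedes x y ∧ avoiding w r x y
    from-w x y = ⌊ x ≟ w ⌋ ∧ (precedes x y ∧ r x y)
    to-w x y = ⌊ y ≟ w ⌋ ∧ (precedes x y ∧ r x y)
    same-pair : ∀ x y → ⌊ x ≟ w ⌋ ≡ true → ⌊ y ≟ w ⌋ ≡ true → precedes x y ≡ false
    same-pair x y x=w y=w with x ≟ w | y ≟ w
    ... | yes refl | yes refl with toℕ x <? toℕ x
    ...   | yes x<x = ⊥-elim (<-irrefl refl x<x)
    ...   | no _ = refl
    no-loop-at : ∀ {y} → y ≡ w → r w y ≡ false
    no-loop-at refl = no-loop

  module _ {n} (G : Graph n) where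

    crossAdj-sym : ∀ (A B : VSet n) x y → crossAdj G A B x y ≡ crossAdj G A B y x
    crossAdj-sym A B x y =
      cong₂ _∧_ (Graph.sym G x y)
        (trans (∨-comm (A x ∧ B y) (B x ∧ A y)) (cong₂ _∨_ (∧-comm (B x) (A y)) (∧-comm (A x) (B y))))

    crossAdj-loop : ∀ (A B : VSet n) w → crossAdj G A B w w ≡ false
    crossAdj-loop A B w rewrite Graph.irrefl G w = refl

    crossAdj-degree : ∀ (A B : VSet n) w → A w ≡ true → B w ≡ false →
      count (crossAdj G A B w) ≡ degIn G B w
    crossAdj-degree A B w Aw Bw = sumF-cong pointwise
      where
      pointwise : ∀ y → ι (crossAdj G A B w y) ≡ ι (B y ∧ adj G w y)
      pointwise y rewrite Aw | Bw = cong ι (trans (cong (adj G w y ∧_) (∨-identityʳ (B y))) (∧-comm _ (B y)))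

    degIn-∨ : ∀ (S S' : VSet n) v → degIn G (λ y → S y ∨ S' y) v ≤ degIn G S v + degIn G S' v
    degIn-∨ S S' v = ≤-trans (sumF-mono (λ y → union (S y) (S' y) (adj G v y)))
                             (≤-reflexive (sumF-+ (λ y → ι (S y ∧ adj G v y)) (λ y → ι (S' y ∧ adj G v y))))
      where
      union : ∀ s s' j → ι ((s ∨ s') ∧ j) ≤ ι (s ∧ j) + ι (s' ∧ j)
      union true s' j = m≤m+n (ι j) _
      union false s' j = ≤-refl

  override : ∀ {n} → Fin n → Bool → VSet n → VSet n
  override w b S x = if ⌊ x ≟ w ⌋ then b else S x

  override-at : ∀ {n} (w : Fin n) b S → override w b S w ≡ b
  override-at w b S with w ≟ w
  ... | yes _ = refl
  ... | no w≢w = ⊥-elim (w≢w refl)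

  module MoveVertex {n} (G : Graph n) {T A B : VSet n} (part : IsPartition T A B)
                    (w : Fin n) (Aw : A w ≡ true) where

    A' B' : VSet n
    A' = override w false A
    B' = override w true B

    Bw : B w ≡ false
    Bw = trans (cong (_∧ B w) (sym Aw)) (proj₂ part w)

    moved-partition : IsPartition T A' B'
    moved-partition = covers , disjoint
      where
      covers : ∀ x → T x ≡ (A' x ∨ B' x)
      covers x with x ≟ w
      ... | yes refl = trans (proj₁ part x) (cong (_∨ B x) Aw)
      ... | no _ = proj₁ part x
      disjoint : ∀ x → (A' x ∧ B' x) ≡ false
      disjoint x with x ≟ w
      ... | yes _ = refl
      ... | no _ = proj₂ part x

    same-away : ∀ x y → avoiding w (crossAdj G A' B') x y ≡ avoiding w (crossAdj G A B) x y
    same-away x y with x ≟ w | y ≟ w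
    ... | yes _ | _ = refl
    ... | no _ | yes _ = refl
    ... | no _ | no _ = refl

    moved-degree : count (crossAdj G A' B' w) ≡ degIn G A w
    moved-degree = sumF-cong pointwise
      where
      pointwise : ∀ y → ι (crossAdj G A' B' w y) ≡ ι (A y ∧ adj G w y)
      pointwise y rewrite override-at w false A | override-at w true B with y ≟ w
      ... | yes refl rewrite Graph.irrefl G y = cong ι (sym (∧-zeroʳ (A y)))
      ... | no _ = cong ι (∧-comm (adj G w y) (A y))

  -- Local optimality of a maximum cut: a vertex of A has at least half of its
  -- T-neighbours across the cut, for otherwise moving it to B would enlarge the cut.
  maxCut-degree : ∀ {n} (G : Graph n) {T A B : VSet n} → IsMaxBipartite G T A B →
    ∀ w → A w ≡ true → degIn G T w ≤ 2 * count (crossAdj G A B w)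
  maxCut-degree G {T} {A} {B} (part , maximal) w Aw = begin
    degIn G T w                     ≡⟨ sumF-cong (λ y → cong (λ t → ι (t ∧ adj G w y)) (proj₁ part y)) ⟩
    degIn G (λ y → A y ∨ B y) w     ≤⟨ degIn-∨ G A B w ⟩
    degIn G A w + degIn G B w       ≤⟨ +-monoˡ-≤ (degIn G B w) moving-loses ⟩
    degIn G B w + degIn G B w       ≡⟨ cong (degIn G B w +_) (sym (+-identityʳ (degIn G B w))) ⟩
    2 * degIn G B w                 ≡⟨ cong (2 *_) (sym (crossAdj-degree G A B w Aw Bw)) ⟩
    2 * count (crossAdj G A B w)    ∎
    where
    open Data.Nat.Properties.≤-Reasoning
    open MoveVertex G {T} {A} {B} part w Aw
    rest = edgeCountRel (avoiding w (crossAdj G A B))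
    before : edgeCountRel (crossAdj G A B) ≡ rest + degIn G B w
    before = trans (edgeCount-split (crossAdj G A B) w (crossAdj-sym G A B) (crossAdj-loop G A B w))
                   (cong (rest +_) (crossAdj-degree G A B w Aw Bw))
    after : edgeCountRel (crossAdj G A' B') ≡ rest + degIn G A w
    after = trans (edgeCount-split (crossAdj G A' B') w (crossAdj-sym G A' B') (crossAdj-loop G A' B' w))
                  (cong₂ _+_ (sumF-cong (λ x → sumF-cong (λ y → cong (λ b → ι (precedes x y ∧ b)) (same-away x y))))
                             moved-degree)
    moving-loses : degIn G A w ≤ degIn G B w
    moving-loses = +-cancelˡ-≤ rest _ _
      (subst₂ _≤_ after before (maximal A' B' moved-partition))

module GreedyIndependent where
  open import Defs using (count; VSet)
  open import Data.Nat using (ℕ; zero; suc; _+_; _*_; _≤_; _<_; z≤n; s≤s)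
  open import Data.Nat.Properties
    using (≤-trans; ≤-reflexive; ≤-refl; n≮0; *-zeroʳ; *-monoʳ-≤; +-monoʳ-≤;
           +-comm; +-cancelˡ-<)
  open import Data.Fin using (Fin; _≟_)
  open import Data.Bool using (Bool; true; false; _∧_; not)
  open import Data.List using (List; []; _∷_; length)
  open import Data.List.Relation.Unary.All as All using (All; []; _∷_)
  open import Data.List.Relation.Unary.AllPairs using (AllPairs; []; _∷_)
  open import Data.Product using (Σ; _×_; _,_)
  open import Data.Empty using (⊥-elim)
  open import Relation.Nullary.Decidable using (⌊_⌋; yes; no)
  open import Relation.Binary.PropositionalEquality
    using (_≡_; _≢_; refl; trans; cong; subst)
  open import Data.Nat.Tactic.RingSolver using (solve-∀)
  open FiniteSums

  Independent : ∀ {n} → (Fin n → Fin n → Bool) → Fin n → Fin n → Set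
  Independent R w w' = R w w' ≡ false × w' ≢ w

  distinct : ∀ {n} (x y : Fin n) → ⌊ x ≟ y ⌋ ≡ false → x ≢ y
  distinct x y e with x ≟ y
  distinct x y () | yes _
  distinct x y _  | no x≢y = x≢y

  discard : ∀ {n} → (Fin n → Fin n → Bool) → VSet n → Fin n → VSet n
  discard R X w y = X y ∧ (not ⌊ y ≟ w ⌋ ∧ not (R w y))

  kept : ∀ x e r → (x ∧ (not e ∧ not r)) ≡ true → x ≡ true × e ≡ false × r ≡ false
  kept true false false refl = refl , refl , refl

  module _ {n} (R : Fin n → Fin n → Bool) (X : VSet n) (w : Fin n) where

    discard-⊆ : ∀ y → discard R X w y ≡ true → X y ≡ true
    discard-⊆ y kept-y with kept (X y) ⌊ y ≟ w ⌋ (R w y) kept-y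
    ... | Xy , _ = Xy

    discard-independent : ∀ y → discard R X w y ≡ true → Independent R w y
    discard-independent y kept-y with kept (X y) ⌊ y ≟ w ⌋ (R w y) kept-y
    ... | _ , y≢w , ¬Rwy = ¬Rwy , distinct y w y≢w

    -- Each vertex of X is kept, is w itself, or is an R-neighbour of w.
    discard-size : X w ≡ true → count X ≤ count (discard R X w) + (1 + count (λ y → X y ∧ R w y))
    discard-size Xw = ≤-trans (sumF-mono (λ y → kept-or-discarded (X y) ⌊ y ≟ w ⌋ (R w y)))
      (≤-reflexive (trans (sumF-+ (λ y → ι (discard R X w y)) _)
        (cong (count (discard R X w) +_)
          (trans (sumF-+ (λ y → ι (⌊ y ≟ w ⌋ ∧ X y)) (λ y → ι (X y ∧ R w y)))
                 (cong (_+ count (λ y → X y ∧ R w y)) (trans (count-at w X) (cong ι Xw)))))))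
      where
      kept-or-discarded : ∀ x e r → ι x ≤ ι (x ∧ (not e ∧ not r)) + (ι (e ∧ x) + ι (x ∧ r))
      kept-or-discarded false e r = z≤n
      kept-or-discarded true true r = s≤s z≤n
      kept-or-discarded true false true = ≤-refl
      kept-or-discarded true false false = s≤s z≤n

  positive-factor : ∀ {x} a c → x < a * c → 0 < c
  positive-factor {x} a zero x<a*0 = ⊥-elim (n≮0 (subst (x <_) (*-zeroʳ a) x<a*0))
  positive-factor a (suc c) _ = s≤s z≤n

  greedy : ∀ {n} (R : Fin n → Fin n → Bool) (K N m : ℕ) (X : VSet n) →
    (∀ w → X w ≡ true → K * count (λ y → X y ∧ R w y) ≤ N) →
    m * (K + N) < K * count X →
    Σ (List (Fin n)) λ I → length I ≡ suc m × All (λ w → X w ≡ true) I × AllPairs (Independent R) I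
  greedy R K N zero X sparse large with count-witness X (positive-factor K (count X) large)
  ... | w , Xw = (w ∷ []) , refl , (Xw ∷ []) , ([] ∷ [])
  greedy R K N (suc m) X sparse large with count-witness X (positive-factor K (count X) large)
  ... | w , Xw with greedy R K N m (discard R X w) sparse' large'
    where
    sparse' : ∀ v → discard R X w v ≡ true → K * count (λ y → discard R X w y ∧ R v y) ≤ N
    sparse' v kept-v = ≤-trans (*-monoʳ-≤ K (count-mono inner)) (sparse v (discard-⊆ R X w v kept-v))
      where
      inner : ∀ y → (discard R X w y ∧ R v y) ≡ true → (X y ∧ R v y) ≡ true
      inner y e with discard R X w y in kept-y
      ... | true rewrite discard-⊆ R X w y kept-y = e
    large' : m * (K + N) < K * count (discard R X w)
    large' = +-cancelˡ-< (K + N) _ _ (begin-strict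
      (K + N) + m * (K + N)                             <⟨ large ⟩
      K * count X                                       ≤⟨ *-monoʳ-≤ K (discard-size R X w Xw) ⟩
      K * (count (discard R X w) + (1 + neighbours))    ≡⟨ distribute K (count (discard R X w)) neighbours ⟩
      K * count (discard R X w) + (K + K * neighbours)  ≤⟨ +-monoʳ-≤ (K * count (discard R X w)) (+-monoʳ-≤ K (sparse w Xw)) ⟩
      K * count (discard R X w) + (K + N)               ≡⟨ +-comm _ (K + N) ⟩
      (K + N) + K * count (discard R X w)               ∎)
      where
      open Data.Nat.Properties.≤-Reasoning
      neighbours = count (λ y → X y ∧ R w y)
      distribute : ∀ k a b → k * (a + (1 + b)) ≡ k * a + (k + k * b)
      distribute = solve-∀
  ... | I , |I| , I⊆discard , independent =
          (w ∷ I) , cong suc |I| ,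
          (Xw ∷ All.map (λ {y} → discard-⊆ R X w y) I⊆discard) ,
          (All.map (λ {y} → discard-independent R X w y) I⊆discard ∷ independent)

module Bonferroni where
  open import Defs using (sumF; count; VSet; codeg)
  open import Data.Nat using (ℕ; zero; suc; _+_; _*_; _≤_; z≤n)
  open import Data.Nat.Properties
    using (≤-trans; ≤-reflexive; ≤-refl; +-mono-≤; +-monoˡ-≤; +-monoʳ-≤; *-zeroʳ;
           *-distribˡ-+; *-distribʳ-+; +-assoc; m≤m+n; n≤1+n)
  open import Data.Fin using (Fin)
  open import Data.Bool using (Bool; true; false; _∧_; _∨_)
  open import Data.Bool.Properties using (∧-zeroʳ)
  open import Data.List using (List; []; _∷_; length; map)
  open import Data.Nat.ListAction using (sum)
  open import Data.List.Relation.Unary.All using (All; []; _∷_)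
  open import Data.List.Relation.Unary.AllPairs using (AllPairs; []; _∷_)
  open import Relation.Binary.PropositionalEquality using (_≡_; sym; trans; cong)
  open import Data.Nat.Tactic.RingSolver using (solve-∀)
  open FiniteSums

  -- The number of 2-element subsets of an m-element set.
  pairs : ℕ → ℕ
  pairs zero = 0
  pairs (suc m) = m + pairs m

  pairs-bound : ∀ m → 2 * pairs m ≤ m * m
  pairs-bound zero = z≤n
  pairs-bound (suc m) = begin
    2 * (m + pairs m)         ≡⟨ *-distribˡ-+ 2 m (pairs m) ⟩
    2 * m + 2 * pairs m       ≤⟨ +-monoʳ-≤ (2 * m) (pairs-bound m) ⟩
    2 * m + m * m             ≤⟨ n≤1+n _ ⟩
    suc (2 * m + m * m)       ≡⟨ square m ⟩
    suc m * suc m             ∎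
    where
    open Data.Nat.Properties.≤-Reasoning
    square : ∀ m → suc (2 * m + m * m) ≡ suc m * suc m
    square = solve-∀

  sum-lower : ∀ {A : Set} (f : A → ℕ) (c d : ℕ) (I : List A) →
    All (λ w → c ≤ d * f w) I → length I * c ≤ d * sum (map f I)
  sum-lower f c d [] [] = z≤n
  sum-lower f c d (w ∷ I) (c≤ ∷ rest) =
    ≤-trans (+-mono-≤ c≤ (sum-lower f c d I rest)) (≤-reflexive (sym (*-distribˡ-+ d (f w) _)))

  sum-upper : ∀ {A : Set} (f : A → ℕ) (c e : ℕ) (I : List A) →
    All (λ w → c * f w ≤ e) I → c * sum (map f I) ≤ length I * e
  sum-upper f c e [] [] = ≤-reflexive (*-zeroʳ c)
  sum-upper f c e (w ∷ I) (≤e ∷ rest) =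
    ≤-trans (≤-reflexive (*-distribˡ-+ c (f w) _)) (+-mono-≤ ≤e (sum-upper f c e I rest))

  module _ {n} (h : Fin n → Fin n → Bool) where

    neighbourhoodUnion : List (Fin n) → VSet n
    neighbourhoodUnion [] z = false
    neighbourhoodUnion (w ∷ I) z = h w z ∨ neighbourhoodUnion I z

    pairCodegrees : List (Fin n) → ℕ
    pairCodegrees [] = 0
    pairCodegrees (w ∷ I) = sum (map (codeg h w) I) + pairCodegrees I

    sum-swap : ∀ (f : Fin n → Fin n → ℕ) I →
      sumF (λ z → sum (map (λ w → f w z) I)) ≡ sum (map (λ w → sumF (f w)) I)
    sum-swap f [] = sumF-zero {n}
    sum-swap f (w ∷ I) = trans (sumF-+ (f w) _) (cong (sumF (f w) +_) (sum-swap f I))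

    intersection-bound : ∀ w I → count (λ z → h w z ∧ neighbourhoodUnion I z) ≤ sum (map (codeg h w) I)
    intersection-bound w I =
      ≤-trans (sumF-mono (pointwise I)) (≤-reflexive (sum-swap (λ w' z → ι (h w z ∧ h w' z)) I))
      where
      union-bound : ∀ a b c → ι (a ∧ (b ∨ c)) ≤ ι (a ∧ b) + ι (a ∧ c)
      union-bound true true c = m≤m+n 1 _
      union-bound true false c = ≤-refl
      union-bound false b c = z≤n
      pointwise : ∀ I z → ι (h w z ∧ neighbourhoodUnion I z) ≤ sum (map (λ w' → ι (h w z ∧ h w' z)) I)
      pointwise [] z = ≤-reflexive (cong ι (∧-zeroʳ (h w z)))
      pointwise (w' ∷ I) z =
        ≤-trans (union-bound (h w z) (h w' z) _) (+-monoʳ-≤ (ι (h w z ∧ h w' z)) (pointwise I z))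

    bonferroni : ∀ I → sum (map (λ w → count (h w)) I) ≤ count (neighbourhoodUnion I) + pairCodegrees I
    bonferroni [] = z≤n
    bonferroni (w ∷ I) = begin
      count (h w) + sum (map (λ w → count (h w)) I)
        ≤⟨ +-monoʳ-≤ (count (h w)) (bonferroni I) ⟩
      count (h w) + (count U + pairCodegrees I)
        ≡⟨ sym (+-assoc (count (h w)) (count U) _) ⟩
      count (h w) + count U + pairCodegrees I
        ≤⟨ +-monoˡ-≤ (pairCodegrees I) two-sets ⟩
      count (neighbourhoodUnion (w ∷ I)) + sum (map (codeg h w) I) + pairCodegrees I
        ≡⟨ +-assoc (count (neighbourhoodUnion (w ∷ I))) _ _ ⟩
      count (neighbourhoodUnion (w ∷ I)) + pairCodegrees (w ∷ I) ∎
      where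
      open Data.Nat.Properties.≤-Reasoning
      U = neighbourhoodUnion I
      inclusion-exclusion : ∀ a b → ι a + ι b ≤ ι (a ∨ b) + ι (a ∧ b)
      inclusion-exclusion true true = ≤-refl
      inclusion-exclusion true false = ≤-refl
      inclusion-exclusion false b = m≤m+n (ι b) 0
      two-sets : count (h w) + count U ≤ count (neighbourhoodUnion (w ∷ I)) + sum (map (codeg h w) I)
      two-sets = begin
        count (h w) + count U
          ≡⟨ sym (sumF-+ (λ z → ι (h w z)) (λ z → ι (U z))) ⟩
        sumF (λ z → ι (h w z) + ι (U z))
          ≤⟨ sumF-mono (λ z → inclusion-exclusion (h w z) (U z)) ⟩
        sumF (λ z → ι (h w z ∨ U z) + ι (h w z ∧ U z))
          ≡⟨ sumF-+ (λ z → ι (h w z ∨ U z)) (λ z → ι (h w z ∧ U z)) ⟩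
        count (neighbourhoodUnion (w ∷ I)) + count (λ z → h w z ∧ U z)
          ≤⟨ +-monoʳ-≤ (count (neighbourhoodUnion (w ∷ I))) (intersection-bound w I) ⟩
        count (neighbourhoodUnion (w ∷ I)) + sum (map (codeg h w) I) ∎

    pairCodegrees-bound : ∀ (c e : ℕ) I → AllPairs (λ w w' → c * codeg h w w' ≤ e) I →
      c * pairCodegrees I ≤ pairs (length I) * e
    pairCodegrees-bound c e [] [] = ≤-reflexive (*-zeroʳ c)
    pairCodegrees-bound c e (w ∷ I) (first ∷ rest) =
      ≤-trans (≤-reflexive (*-distribˡ-+ c _ (pairCodegrees I)))
        (≤-trans (+-mono-≤ (sum-upper (codeg h w) c e I first) (pairCodegrees-bound c e I rest))
                 (≤-reflexive (sym (*-distribʳ-+ e (length I) (pairs (length I))))))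

    neighbourhoodUnion-⊆ : ∀ (B : VSet n) I → All (λ w → ∀ z → h w z ≡ true → B z ≡ true) I →
      count (neighbourhoodUnion I) ≤ count B
    neighbourhoodUnion-⊆ B I all⊆ = count-mono (inside I all⊆)
      where
      inside : ∀ I → All (λ w → ∀ z → h w z ≡ true → B z ≡ true) I →
               ∀ z → neighbourhoodUnion I z ≡ true → B z ≡ true
      inside (w ∷ I) (w⊆ ∷ rest) z e with h w z in hwz
      ... | true = w⊆ z hwz
      ... | false = inside I rest z e

module Arithmetic where
  open import Data.Nat using (ℕ; suc; _+_; _*_; _∸_; _≤_; _<_)
  open import Data.Nat.Properties
    using (*-assoc; *-comm; *-cancelˡ-≤; *-distribˡ-+; *-mono-<; *-monoʳ-<; *-monoʳ-≤; *-monoˡ-≤;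
           +-cancelˡ-<; +-cancelˡ-≤; +-mono-≤; +-monoʳ-≤; +-monoˡ-<; +-monoˡ-≤; <-irrefl; <⇒≤;
           m≤m+n; m+[n∸m]≡n; module ≤-Reasoning)
  open import Data.Nat.DivMod using (_/_; _%_; m≡m%n+[m/n]*n; m%n<n; m/n*n≤m)
  open import Data.Product using (Σ; _×_; _,_)
  open import Data.Empty using (⊥)
  open import Relation.Binary.PropositionalEquality using (_≡_; refl; sym; cong; subst)
  open import Data.Nat.Tactic.RingSolver using (solve-∀)

  family-size : ∀ a b → 1 ≤ b → b < a → Σ ℕ λ m → 4 * a < suc m * b × suc m * b ≤ 8 * a
  family-size a b@(suc _) _ b<a = m , lower , upper
    where
    m = 4 * (a / b) + 3
    open ≤-Reasoning
    shape : ∀ q b → 4 * b + 4 * (q * b) ≡ suc (4 * q + 3) * b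
    shape = solve-∀
    lower : 4 * a < suc m * b
    lower = begin-strict
      4 * a                          ≡⟨ cong (4 *_) (m≡m%n+[m/n]*n a b) ⟩
      4 * (a % b + a / b * b)        ≡⟨ *-distribˡ-+ 4 (a % b) (a / b * b) ⟩
      4 * (a % b) + 4 * (a / b * b)  <⟨ +-monoˡ-< (4 * (a / b * b)) (*-monoʳ-< 4 (m%n<n a b)) ⟩
      4 * b + 4 * (a / b * b)        ≡⟨ shape (a / b) b ⟩
      suc m * b                      ∎
    upper : suc m * b ≤ 8 * a
    upper = begin
      suc m * b                ≡⟨ sym (shape (a / b) b) ⟩
      4 * b + 4 * (a / b * b)  ≤⟨ +-mono-≤ (*-monoʳ-≤ 4 (<⇒≤ b<a)) (*-monoʳ-≤ 4 (m/n*n≤m a b)) ⟩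
      4 * a + 4 * a            ≡⟨ double a ⟩
      8 * a                    ∎
      where
      double : ∀ a → 4 * a + 4 * a ≡ 8 * a
      double = solve-∀

  -- The quadratic x² − 16ax + 32a² is negative for 4a < x ≤ 8a: writing 8a = x + e,
  -- where e < x, the inequality below becomes 2x² + 4xe ≤ 2e².
  quadratic-gap : ∀ a x → 4 * a < x → x ≤ 8 * a → 16 * a * x ≤ 32 * (a * a) + x * x → ⊥
  quadratic-gap a x 4a<x x≤8a h = <-irrefl refl (begin-strict
    2 * (e * e)                    <⟨ *-monoʳ-< 2 (*-mono-< e<x e<x) ⟩
    2 * (x * x)                    ≤⟨ m≤m+n (2 * (x * x)) (4 * (x * e)) ⟩
    2 * (x * x) + 4 * (x * e)      ≤⟨ +-cancelˡ-≤ (6 * (x * x) + 4 * (x * e)) _ _ scaled ⟩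
    2 * (e * e)                    ∎)
    where
    open ≤-Reasoning
    e = 8 * a ∸ x
    x+e : x + e ≡ 8 * a
    x+e = m+[n∸m]≡n x≤8a
    e<x : e < x
    e<x = +-cancelˡ-< x e x (begin-strict
      x + e        ≡⟨ x+e ⟩
      8 * a        ≡⟨ double a ⟩
      2 * (4 * a)  <⟨ *-monoʳ-< 2 4a<x ⟩
      2 * x        ≡⟨ twice x ⟩
      x + x        ∎)
      where
      double : ∀ a → 8 * a ≡ 2 * (4 * a)
      double = solve-∀
      twice : ∀ x → 2 * x ≡ x + x
      twice = solve-∀
    -- h multiplied by 4 and expressed through x and e
    scaled : 6 * (x * x) + 4 * (x * e) + (2 * (x * x) + 4 * (x * e)) ≤ 6 * (x * x) + 4 * (x * e) + 2 * (e * e)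
    scaled = begin
      6 * (x * x) + 4 * (x * e) + (2 * (x * x) + 4 * (x * e)) ≡⟨ left x e ⟩
      8 * (x + e) * x                                          ≡⟨ cong (λ t → 8 * t * x) x+e ⟩
      8 * (8 * a) * x                                          ≡⟨ by-a a x ⟩
      4 * (16 * a * x)                                         ≤⟨ *-monoʳ-≤ 4 h ⟩
      4 * (32 * (a * a) + x * x)                               ≡⟨ by-a′ a x ⟩
      2 * ((8 * a) * (8 * a)) + 4 * (x * x)                    ≡⟨ cong (λ t → 2 * (t * t) + 4 * (x * x)) (sym x+e) ⟩
      2 * ((x + e) * (x + e)) + 4 * (x * x)                    ≡⟨ right x e ⟩
      6 * (x * x) + 4 * (x * e) + 2 * (e * e)                  ∎
      where
      left : ∀ x e → 6 * (x * x) + 4 * (x * e) + (2 * (x * x) + 4 * (x * e)) ≡ 8 * (x + e) * x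
      left = solve-∀
      by-a : ∀ a x → 8 * (8 * a) * x ≡ 4 * (16 * a * x)
      by-a = solve-∀
      by-a′ : ∀ a x → 4 * (32 * (a * a) + x * x) ≡ 2 * ((8 * a) * (8 * a)) + 4 * (x * x)
      by-a′ = solve-∀
      right : ∀ x e → 2 * ((x + e) * (x + e)) + 4 * (x * x) ≡ 6 * (x * x) + 4 * (x * e) + 2 * (e * e)
      right = solve-∀

  -- m vertices whose degrees are at least nb/(4a), whose neighbourhoods lie in a set of
  -- size U ≤ n/2 and whose P = C(m,2) pairwise codegrees sum to C ≤ P·nb²/(32a²)
  -- cannot exist when 4a < mb ≤ 8a: Bonferroni (D ≤ U + C) would force the quadratic
  -- inequality 16a(mb) ≤ 32a² + (mb)².
  family-contradiction : ∀ a b n m U D C P → 0 < b → 0 < n →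
    4 * a < m * b → m * b ≤ 8 * a →
    m * (n * b) ≤ 4 * a * D → D ≤ U + C → 2 * U ≤ n →
    32 * (a * a) * C ≤ P * (n * (b * b)) → 2 * P ≤ m * m → ⊥
  family-contradiction a b@(suc _) n@(suc _) m U D C P _ _ lower upper degrees bonferroni union codegrees pairs =
    quadratic-gap a (m * b) lower upper quadratic
    where
    open ≤-Reasoning
    scaled : (n * b) * (8 * a * (m * b)) ≤ (n * b) * (16 * (a * a) + P * (b * b))
    scaled = begin
      (n * b) * (8 * a * (m * b))                       ≡⟨ l₁ n b a m ⟩
      8 * a * b * (m * (n * b))                         ≤⟨ *-monoʳ-≤ (8 * a * b) degrees ⟩
      8 * a * b * (4 * a * D)                           ≤⟨ *-monoʳ-≤ (8 * a * b) (*-monoʳ-≤ (4 * a) bonferroni) ⟩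
      8 * a * b * (4 * a * (U + C))                     ≡⟨ l₂ a b U C ⟩
      16 * (a * a) * b * (2 * U) + b * (32 * (a * a) * C)
        ≤⟨ +-mono-≤ (*-monoʳ-≤ (16 * (a * a) * b) union) (*-monoʳ-≤ b codegrees) ⟩
      16 * (a * a) * b * n + b * (P * (n * (b * b)))    ≡⟨ l₃ a b n P ⟩
      (n * b) * (16 * (a * a) + P * (b * b))            ∎
      where
      l₁ : ∀ n b a m → (n * b) * (8 * a * (m * b)) ≡ 8 * a * b * (m * (n * b))
      l₁ = solve-∀
      l₂ : ∀ a b U C → 8 * a * b * (4 * a * (U + C)) ≡ 16 * (a * a) * b * (2 * U) + b * (32 * (a * a) * C)
      l₂ = solve-∀
      l₃ : ∀ a b n P → 16 * (a * a) * b * n + b * (P * (n * (b * b))) ≡ (n * b) * (16 * (a * a) + P * (b * b))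
      l₃ = solve-∀
    quadratic : 16 * a * (m * b) ≤ 32 * (a * a) + (m * b) * (m * b)
    quadratic = begin
      16 * a * (m * b)                        ≡⟨ l₁ a m b ⟩
      2 * (8 * a * (m * b))                   ≤⟨ *-monoʳ-≤ 2 (*-cancelˡ-≤ (n * b) scaled) ⟩
      2 * (16 * (a * a) + P * (b * b))        ≡⟨ l₂ a P b ⟩
      32 * (a * a) + (2 * P) * (b * b)        ≤⟨ +-monoʳ-≤ (32 * (a * a)) (*-monoˡ-≤ (b * b) pairs) ⟩
      32 * (a * a) + (m * m) * (b * b)        ≡⟨ l₃ a m b ⟩
      32 * (a * a) + (m * b) * (m * b)        ∎
      where
      l₁ : ∀ a m b → 16 * a * (m * b) ≡ 2 * (8 * a * (m * b))
      l₁ = solve-∀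
      l₂ : ∀ a P b → 2 * (16 * (a * a) + P * (b * b)) ≡ 32 * (a * a) + (2 * P) * (b * b)
      l₂ = solve-∀
      l₃ : ∀ a m b → 32 * (a * a) + (m * m) * (b * b) ≡ 32 * (a * a) + (m * b) * (m * b)
      l₃ = solve-∀

  -- Turning the greedy bound K·s ≤ m·(K+N), with K = 16·c·a⁵ ≤ N = n·b⁵ and mb ≤ 8a,
  -- into c·a⁴·s ≤ n·b⁴  (i.e. s ≤ 2m·N/K ≤ 16(a/b)·N/K).
  greedy-size-bound : ∀ c a b n m s A4 B4 → 0 < a → 0 < b →
    16 * c * (a * A4) * s ≤ m * (16 * c * (a * A4) + n * (b * B4)) →
    m * b ≤ 8 * a → 16 * c * (a * A4) ≤ n * (b * B4) → c * A4 * s ≤ n * B4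
  greedy-size-bound c a@(suc _) b@(suc _) n m s A4 B4 _ _ greedy-bound upper K≤N =
    *-cancelˡ-≤ (16 * a * b) (begin
      16 * a * b * (c * A4 * s)  ≡⟨ l₁ c a b A4 s ⟩
      b * (K * s)                ≤⟨ *-monoʳ-≤ b greedy-bound ⟩
      b * (m * (K + N))          ≡⟨ sym (*-assoc b m (K + N)) ⟩
      (b * m) * (K + N)          ≤⟨ *-monoˡ-≤ (K + N) (subst (_≤ 8 * a) (*-comm m b) upper) ⟩
      8 * a * (K + N)            ≤⟨ *-monoʳ-≤ (8 * a) (+-monoˡ-≤ N K≤N) ⟩
      8 * a * (N + N)            ≡⟨ l₂ a n b B4 ⟩
      16 * a * b * (n * B4)      ∎)
    where
    open ≤-Reasoning
    K = 16 * c * (a * A4)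
    N = n * (b * B4)
    l₁ : ∀ c a b A4 s → 16 * a * b * (c * A4 * s) ≡ b * (16 * c * (a * A4) * s)
    l₁ = solve-∀
    l₂ : ∀ a n b B4 → 8 * a * (n * (b * B4) + n * (b * B4)) ≡ 16 * a * b * (n * B4)
    l₂ = solve-∀

module FewBadVertices where
  open import Defs using (count; VSet; codeg)
  open import Data.Nat using (ℕ; zero; suc; _+_; _*_; _^_; _≤_; _<_; z≤n; s≤s)
  open import Data.Nat.Properties
    using (≤-trans; ≮⇒≥; *-monoʳ-≤; *-monoˡ-≤; n≤1+n; *-zeroʳ; <⇒≤; ≤-reflexive)
  open import Data.Fin using (Fin)
  open import Data.Bool using (Bool; true; false; _∧_)
  open import Data.List using (List; []; _∷_; length; map)
  open import Data.Nat.ListAction using (sum)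
  open import Data.List.Relation.Unary.All as All using (All; []; _∷_)
  open import Data.List.Relation.Unary.AllPairs as AllPairs using (AllPairs; []; _∷_)
  open import Data.Product using (_×_; _,_)
  open import Data.Empty using (⊥)
  open import Relation.Binary.PropositionalEquality using (_≡_; _≢_; refl; subst)
  open GreedyIndependent using (Independent; greedy)
  open Bonferroni
  open Arithmetic

  allPairs-with-ends : ∀ {A : Set} {P : A → Set} {R : A → A → Set} {I : List A} →
    All P I → AllPairs R I → AllPairs (λ x y → P x × P y × R x y) I
  allPairs-with-ends [] [] = []
  allPairs-with-ends (px ∷ ps) (rx ∷ rs) =
    All.zipWith (λ { (py , r) → px , py , r }) (ps , rx) ∷ allPairs-with-ends ps rs

  few-bad : ∀ {n} (h R : Fin n → Fin n → Bool) (B S : VSet n) (c d a b : ℕ) → d ≡ 16 * c →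
    1 ≤ b → b < a → d * a ^ 5 ≤ n * b ^ 5 → 2 * count B ≤ n →
    (∀ w → S w ≡ true → n * b ≤ 4 * a * count (h w)) →
    (∀ w z → S w ≡ true → h w z ≡ true → B z ≡ true) →
    (∀ w → S w ≡ true → d * a ^ 5 * count (λ y → S y ∧ R w y) ≤ n * b ^ 5) →
    (∀ w w' → S w ≡ true → S w' ≡ true → R w w' ≡ false → w' ≢ w →
       32 * (a * a) * codeg h w w' ≤ n * (b * b)) →
    c * a ^ 4 * count S ≤ n * b ^ 4
  few-bad {zero} h R B S c d a b _ _ _ _ _ _ _ _ _ = ≤-reflexive (*-zeroʳ (c * a ^ 4))
  few-bad {n@(suc _)} h R B S c d a@(suc _) b refl 1≤b b<a Δ≥1 small-B degree inside sparse codegree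
    with family-size a b 1≤b b<a
  ... | m , lower , upper =
    greedy-size-bound c a b n m (count S) (a ^ 4) (b ^ 4) (s≤s z≤n) 1≤b
      (≮⇒≥ no-large-independent-family)
      (≤-trans (*-monoˡ-≤ b (n≤1+n m)) upper) Δ≥1
    where
    K = d * a ^ 5
    N = n * b ^ 5
    no-independent-family : ∀ I → length I ≡ suc m → All (λ w → S w ≡ true) I →
                            AllPairs (Independent R) I → ⊥
    no-independent-family I |I| I⊆S independent =
      family-contradiction a b n (suc m) (count (neighbourhoodUnion h I))
        (sum (map (λ w → count (h w)) I)) (pairCodegrees h I) (pairs (suc m)) 1≤b (s≤s z≤n) lower upper
        (subst (λ l → l * (n * b) ≤ 4 * a * sum (map (λ w → count (h w)) I)) |I|
          (sum-lower (λ w → count (h w)) (n * b) (4 * a) I (All.map (λ {w} → degree w) I⊆S)))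
        (bonferroni h I)
        (≤-trans (*-monoʳ-≤ 2 (neighbourhoodUnion-⊆ h B I (All.map (λ {w} Sw z → inside w z Sw) I⊆S))) small-B)
        (subst (λ l → 32 * (a * a) * pairCodegrees h I ≤ pairs l * (n * (b * b))) |I|
          (pairCodegrees-bound h (32 * (a * a)) (n * (b * b)) I
            (AllPairs.map (λ { (Sw , Sw' , (¬R , w'≢w)) → codegree _ _ Sw Sw' ¬R w'≢w })
                          (allPairs-with-ends I⊆S independent))))
        (pairs-bound (suc m))
    no-large-independent-family : m * (K + N) < K * count S → ⊥
    no-large-independent-family large with greedy R K N m S sparse large
    ... | I , |I| , I⊆S , independent = no-independent-family I |I| I⊆S independent

open import Defs hiding (sym)
open import Data.Nat using (ℕ; _≤_)
open import Data.Fin using (Fin)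
open import Data.Bool using (true)
open import Data.Rational using (ℚ; _<_; _*_) renaming (_≤_ to _≤ℚ_)
open import Relation.Binary.PropositionalEquality using (_≡_; _≢_)

open import Data.Nat using (zero; suc; _+_; _^_; z≤n)
  renaming (_*_ to _·_; _<_ to _<ℕ_)
open import Data.Nat.Properties
  using (≤-trans; <⇒≤; *-comm; *-monoˡ-≤; *-monoʳ-≤; +-monoˡ-≤; +-identityʳ; ^-monoʳ-≤; m≤m+n)
open import Data.Fin using (_≟_)
open import Data.Bool using (Bool; false; _∧_; _∨_; not)
open import Data.Product using (_×_; _,_; proj₁; proj₂)
open import Data.Empty using (⊥-elim)
open import Relation.Nullary using (¬_)
open import Relation.Nullary.Decidable using (Dec; ⌊_⌋; yes; no)
open import Relation.Binary.PropositionalEquality using (refl; sym; trans; cong; subst; subst₂)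
open import Function using (_∘_)
import Data.Rational.Properties as ℚP
open import Data.Nat.Tactic.RingSolver using (solve-∀)
open FiniteSums using (count-mono; count-disjoint)
open LocalMaxCut using (maxCut-degree)
open RationalBridge
open FewBadVertices using (few-bad)

∧-elim : ∀ {x y} → (x ∧ y) ≡ true → x ≡ true × y ≡ true
∧-elim {true} {true} refl = refl , refl

∧-intro : ∀ {x y} → x ≡ true → y ≡ true → (x ∧ y) ≡ true
∧-intro refl refl = refl

decided-yes : ∀ {P : Set} (d : Dec P) → ⌊ d ⌋ ≡ true → P
decided-yes (yes p) _ = p

decided-no : ∀ {P : Set} (d : Dec P) → ⌊ d ⌋ ≡ false → ¬ P
decided-no (no ¬p) _ = ¬p

peel-min-degree : ∀ {n} {G : Graph n} {k S T} → Peel G k S T →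
  ∀ v → T v ≡ true → q n ≤ℚ q (degIn G T v) * (q 2 * k)
peel-min-degree (stop min-degree) = min-degree
peel-min-degree (del _ _ _ _ rest) = peel-min-degree rest

-- Pr_A(P)·c·k⁴·|A| ≤ n  follows from  c·a⁴·|P| ≤ n·b⁴  for k = a/b, because the
-- probability is |A ∩ P|/|A| (or 0 when A is empty).
probability-bound : ∀ {n} {k : ℚ} {a b} → Fraction k a b → (A P : VSet n) (c : ℕ) →
  c · a ^ 4 · count P ≤ n · b ^ 4 → Pr A P * (q c * (k ^ℚ 4) * q (count A)) ≤ℚ q n
probability-bound {n} {k} {a} {b} k≐a/b A P c few with count A
... | zero = ≤-nat⁻¹ n (fraction-* fraction-zero (fraction-* (fraction-scale c (fraction-^ k≐a/b 4)) (fraction-q 0))) z≤n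
... | suc m = ≤-nat⁻¹ n (fraction-* (fraction-div |A∩P| m) (fraction-* (fraction-scale c (fraction-^ k≐a/b 4)) (fraction-q (suc m))))
                (subst₂ _≤_ (l₁ c (a ^ 4) |A∩P| m) (l₂ n (b ^ 4) m)
                   (*-monoˡ-≤ (suc m) (≤-trans (*-monoʳ-≤ (c · a ^ 4) (count-mono {P = λ x → A x ∧ P x} (λ x → proj₂ ∘ ∧-elim {A x}))) few)))
  where
  |A∩P| = count (λ x → A x ∧ P x)
  l₁ : ∀ c A4 p m → c · A4 · p · suc m ≡ p · (c · A4 · suc m)
  l₁ = solve-∀
  l₂ : ∀ n B4 m → n · B4 · suc m ≡ n · (suc m · (B4 · 1))
  l₂ = solve-∀

bad-unfold : ∀ {n} (k : ℚ) (h : Fin n → Fin n → Bool) (A : VSet n) {u v w : Fin n} →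
  bad k h A u v w ≡ true →
  NH h u v w ≡ true ×
  q (count (λ x → NH h u v x ∧ ΓAdj k h A w x)) * (q (2 ^ 16) * (k ^ℚ 5)) ≤ℚ q n
bad-unfold {n} k h A {u} {v} {w} bad-w =
  proj₁ parts , decided-yes (Γ-degree ℚP.≤? q n) (proj₂ parts)
  where
  Γ-degree = q (count (λ x → NH h u v x ∧ ΓAdj k h A w x)) * (q (2 ^ 16) * (k ^ℚ 5))
  parts = ∧-elim {NH h u v w} {⌊ q (count (λ x → NH h u v x ∧ ΓAdj k h A w x)) * (q (2 ^ 16) * (k ^ℚ 5)) ℚP.≤? q n ⌋} bad-w

≟-false : ∀ {n} {x y : Fin n} → x ≢ y → ⌊ x ≟ y ⌋ ≡ false
≟-false {x = x} {y} x≢y with x ≟ y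
... | yes x≡y = ⊥-elim (x≢y x≡y)
... | no _ = refl

Γ-unfold : ∀ {n} (k : ℚ) (h : Fin n → Fin n → Bool) (A : VSet n) {w w' : Fin n} →
  A w ≡ true → A w' ≡ true → ΓAdj k h A w w' ≡ false → w' ≢ w →
  q (codeg h w w') * (q 32 * (k ^ℚ 2)) < q n
Γ-unfold {n} k h A {w} {w'} Aw Aw' ¬Γ w'≢w =
  ℚP.≰⇒> (decided-no (q n ℚP.≤? q (codeg h w w') * (q 32 * (k ^ℚ 2)))
                     (last-false Aw Aw' (≟-false (λ w≡w' → w'≢w (sym w≡w'))) ¬Γ))
  where
  last-false : ∀ {a a' e} {d} → a ≡ true → a' ≡ true → e ≡ false → (a ∧ a' ∧ not e ∧ d) ≡ false → d ≡ false
  last-false refl refl refl d≡false = d≡false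

module _ {n} {k : ℚ} {a b : ℕ} (k≐a/b : Fraction k a b) (h : Fin n → Fin n → Bool) (A : VSet n) where

  bad-sparse : ∀ {u v w} → bad k h A u v w ≡ true →
    2 ^ 16 · a ^ 5 · count (λ y → bad k h A u v y ∧ ΓAdj k h A w y) ≤ n · b ^ 5
  bad-sparse {u} {v} {w} bad-w = begin
    2 ^ 16 · a ^ 5 · count (λ y → bad k h A u v y ∧ ΓAdj k h A w y)
      ≤⟨ *-monoʳ-≤ (2 ^ 16 · a ^ 5) (count-mono bad⇒NH) ⟩
    2 ^ 16 · a ^ 5 · count (λ y → NH h u v y ∧ ΓAdj k h A w y)
      ≡⟨ *-comm (2 ^ 16 · a ^ 5) _ ⟩
    count (λ y → NH h u v y ∧ ΓAdj k h A w y) · (2 ^ 16 · a ^ 5)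
      ≤⟨ ≤-nat n (fraction-scale (count (λ y → NH h u v y ∧ ΓAdj k h A w y))
                   (fraction-scale (2 ^ 16) (fraction-^ k≐a/b 5)))
                 (proj₂ (bad-unfold k h A bad-w)) ⟩
    n · b ^ 5 ∎
    where
    open Data.Nat.Properties.≤-Reasoning
    bad⇒NH : ∀ y → (bad k h A u v y ∧ ΓAdj k h A w y) ≡ true → (NH h u v y ∧ ΓAdj k h A w y) ≡ true
    bad⇒NH y e = ∧-intro (proj₁ (bad-unfold k h A (proj₁ (∧-elim {bad k h A u v y} e))))
                         (proj₂ (∧-elim {bad k h A u v y} e))

  Γ-codegree : ∀ {w w'} → A w ≡ true → A w' ≡ true → ΓAdj k h A w w' ≡ false → w' ≢ w →
    32 · (a · a) · codeg h w w' ≤ n · (b · b)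
  Γ-codegree {w} {w'} Aw Aw' ¬Γ w'≢w =
    <⇒≤ (subst₂ _<ℕ_ (l₁ (codeg h w w') a) (l₂ n b)
      (<-nat n (fraction-scale (codeg h w w') (fraction-scale 32 (fraction-^ k≐a/b 2)))
               (Γ-unfold k h A Aw Aw' ¬Γ w'≢w)))
    where
    l₁ : ∀ d a → d · (32 · (a · (a · 1))) ≡ 32 · (a · a) · d
    l₁ = solve-∀
    l₂ : ∀ n b → n · (b · (b · 1)) ≡ n · (b · b)
    l₂ = solve-∀

-- The situation of the theorem: T is what remains of G after the peeling, and
-- crossAdj G A B is a maximum bipartite subgraph H of G[T] with sides A and B.
-- (H and Γ are written out in full: the statements below are then literally
-- the ones in the definition of bad vertices.)
module MaxCutSetting {n : ℕ} (k : ℚ) (G : Graph n) {T A B : VSet n}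
                     (peel : Peel G k full T) (maximum : IsMaxBipartite G T A B) where

  partition : IsPartition T A B
  partition = proj₁ maximum

  A⇒¬B : ∀ {x} → A x ≡ true → B x ≡ false
  A⇒¬B {x} Ax = trans (cong (_∧ B x) (sym Ax)) (proj₂ partition x)

  B⇒¬A : ∀ {x} → B x ≡ true → A x ≡ false
  B⇒¬A {x} Bx with A x in Ax
  ... | false = refl
  ... | true = trans (sym Bx) (A⇒¬B Ax)

  across-A : ∀ {x y} → A x ≡ true → crossAdj G A B x y ≡ true → B y ≡ true
  across-A {x} {y} Ax Hxy rewrite Ax | A⇒¬B Ax with adj G x y | B y | Hxy
  ... | true | true | _ = refl

  across-B : ∀ {x y} → B x ≡ true → crossAdj G A B x y ≡ true → A y ≡ true
  across-B {x} {y} Bx Hxy rewrite Bx | B⇒¬A Bx with adj G x y | A y | Hxy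
  ... | true | true | _ = refl

  small-B : count B ≤ count A → 2 · count B ≤ n
  small-B |B|≤|A| = ≤-trans (subst (_≤ count A + count B) (sym double) (+-monoˡ-≤ (count B) |B|≤|A|))
                            (count-disjoint A B (proj₂ partition))
    where
    double : 2 · count B ≡ count B + count B
    double = cong (count B +_) (+-identityʳ (count B))

  -- Bad vertices are common H-neighbours of u ∈ B, hence lie in A.
  bad-in-A : ∀ {u v w} → B u ≡ true → bad k (crossAdj G A B) A u v w ≡ true → A w ≡ true
  bad-in-A Bu bad-w = across-B Bu (proj₁ (∧-elim (proj₁ (bad-unfold k (crossAdj G A B) A bad-w))))

  -- By the peeling and the maximality of the cut, vertices of A have H-degree ≥ n/(4k).
  degree-bound : ∀ {a b} → Fraction k a b → ∀ {w} → A w ≡ true → n · b ≤ 4 · a · count (crossAdj G A B w)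
  degree-bound {a} {b} k≐a/b {w} Aw = begin
    n · b                                  ≤⟨ nat-≤ n (fraction-scale (degIn G T w) (fraction-scale 2 k≐a/b))
                                                      (peel-min-degree peel w Tw) ⟩
    degIn G T w · (2 · a)                  ≤⟨ *-monoˡ-≤ (2 · a) (maxCut-degree G {T} {A} {B} maximum w Aw) ⟩
    2 · count (crossAdj G A B w) · (2 · a) ≡⟨ reorder (count (crossAdj G A B w)) a ⟩
    4 · a · count (crossAdj G A B w)       ∎
    where
    open Data.Nat.Properties.≤-Reasoning
    Tw : T w ≡ true
    Tw = trans (proj₁ partition w) (cong (_∨ B w) Aw)
    reorder : ∀ d a → 2 · d · (2 · a) ≡ 4 · a · d
    reorder = solve-∀

  bad-vertices-rare : ∀ {a b} → Fraction k a b → b <ℕ a → q (2 ^ 20) * (k ^ℚ 5) < q n →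
    count B ≤ count A → ∀ u v → B u ≡ true →
    Pr A (bad k (crossAdj G A B) A u v) * (q (2 ^ 12) * (k ^ℚ 4) * q (count A)) ≤ℚ q n
  bad-vertices-rare {a} {b} k≐a/b b<a n>2²⁰k⁵ |B|≤|A| u v Bu =
    probability-bound k≐a/b A (bad k (crossAdj G A B) A u v) (2 ^ 12)
      (few-bad (crossAdj G A B) (ΓAdj k (crossAdj G A B) A) B (bad k (crossAdj G A B) A u v)
        (2 ^ 12) (2 ^ 16) a b refl (Fraction.positive k≐a/b) b<a Δ≥1 (small-B |B|≤|A|)
        (λ w Sw → degree-bound k≐a/b (bad-in-A Bu Sw))
        (λ w z Sw → across-A (bad-in-A Bu Sw))
        (λ w Sw → bad-sparse k≐a/b (crossAdj G A B) A Sw)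
        (λ w w' Sw Sw' → Γ-codegree k≐a/b (crossAdj G A B) A (bad-in-A Bu Sw) (bad-in-A Bu Sw')))
    where
    Δ≥1 : 2 ^ 16 · a ^ 5 ≤ n · b ^ 5
    Δ≥1 = ≤-trans (*-monoˡ-≤ (a ^ 5) (^-monoʳ-≤ 2 (m≤m+n 16 4)))
                  (<⇒≤ (<-nat n (fraction-scale (2 ^ 20) (fraction-^ k≐a/b 5)) n>2²⁰k⁵))

lemma3 : (n : ℕ) (k : ℚ) → q 1 < k → q (2 Data.Nat.^ 20) * (k ^ℚ 5) < q n →
         (G : Graph n) → q n * q n ≤ℚ q (edgeCount G) * k →
         (T : VSet n) → Peel G k full T →
         (A B : VSet n) → IsMaxBipartite G T A B → count B ≤ count A →
         (u v : Fin n) → u ≢ v → B u ≡ true → B v ≡ true →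
         Pr A (bad k (crossAdj G A B) A u v) * (q (2 Data.Nat.^ 12) * (k ^ℚ 4) * q (count A))
           ≤ℚ q n
lemma3 n k k>1 n>2²⁰k⁵ G _ T peel A B maximum |B|≤|A| u v _ Bu _ =
  let a , b , k≐a/b , b<a = above-one k k>1
  in MaxCutSetting.bad-vertices-rare k G peel maximum k≐a/b b<a n>2²⁰k⁵ |B|≤|A| u v Bu
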